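{- For every $d\in\mathbb{N}$ and every $0\le k<d$, there exists an infinite sequence $\{\mathcal{F}_n\}_{n\in\mathbb{N}}$ of families of axis-parallel boxes in $\mathbb{R}^d$ such that: (1) for every $n\in\mathbb{N}$, $\mathcal{F}_n$ has no finite axis-parallel $k$-transversal (no finite family of axis-parallel $k$-flats such that every box of $\mathcal{F}_n$ meets one of them); and (2) every infinite sequence $\{B_n\}_{n\in\mathbb{N}}$ with $B_n\in\mathcal{F}_n$ for all $n\in\mathbb{N}$ contains two boxes $B_i,B_j$ with $i\neq j$ that are both intersected by a single axis-parallel $k$-flat.
   Context: An axis-parallel box in $\mathbb{R}^d$ is a set $[a_1,b_1]\times\cdots\times[a_d,b_d]$ with $a_i\le b_i$ real for all $i$. An axis-parallel $k$-flat in $\mathbb{R}^d$ is a set of the form $\{x\in\mathbb{R}^d : x_i=c_i \text{ for all } i\in I\}$ where $I\subseteq\{1,\dots,d\}$ has $|I|=d-k$ and $c_i\in\mathbb{R}$ are fixed. -}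

module Defs where

open import Level using (0ℓ)
open import Data.Nat using (ℕ; _∸_)
open import Data.Fin using (Fin)
open import Data.Fin.Subset using (Subset; _∈_; ∣_∣)
open import Data.List using (List)
open import Data.List.Membership.Propositional renaming (_∈_ to _∈L_)
open import Data.Product using (Σ; ∃; _×_; _,_)
open import Relation.Nullary using (¬_)
open import Relation.Binary.PropositionalEquality using (_≡_)
open import Relation.Binary.Structures using (IsTotalOrder)
open import Algebra.Bundles using (CommutativeRing)

-- The real numbers, axiomatised as a complete ordered field
-- (unique up to isomorphism; the stdlib has no ℝ).
record RealNumbers : Set₁ where
  field
    commRing : CommutativeRing 0ℓ 0ℓ
  open CommutativeRing commRing public hiding (ring)
  field
    _≤_          : Carrier → Carrier → Set
    isTotalOrder : IsTotalOrder _≈_ _≤_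
    +-mono-≤     : ∀ {x y} z → x ≤ y → (x + z) ≤ (y + z)
    *-nonneg     : ∀ {x y} → 0# ≤ x → 0# ≤ y → 0# ≤ (x * y)
    0≉1          : ¬ (0# ≈ 1#)
    inverse      : ∀ x → ¬ (x ≈ 0#) → ∃ λ y → (x * y) ≈ 1#
    completeness : (S : Carrier → Set) → ∃ S →
                   (∃ λ u → ∀ s → S s → s ≤ u) →
                   ∃ λ m → (∀ s → S s → s ≤ m) ×
                           (∀ u → (∀ s → S s → s ≤ u) → m ≤ u)

module _ (ℝ : RealNumbers) where
  open RealNumbers ℝ

  record Box (d : ℕ) : Set where
    constructor box
    field
      lo  : Fin d → Carrier
      hi  : Fin d → Carrier
      lo≤hi : ∀ i → lo i ≤ hi i

  -- Axis-parallel k-flat {x : xᵢ = cᵢ for i ∈ I}, |I| = d - k.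
  -- (values of c outside I are irrelevant)
  record Flat (d k : ℕ) : Set where
    constructor flat
    field
      I    : Subset d
      |I|  : ∣ I ∣ ≡ d ∸ k
      c    : Fin d → Carrier

  InBox : ∀ {d} → (Fin d → Carrier) → Box d → Set
  InBox x B = ∀ i → (Box.lo B i ≤ x i) × (x i ≤ Box.hi B i)

  InFlat : ∀ {d k} → (Fin d → Carrier) → Flat d k → Set
  InFlat x F = ∀ i → i ∈ Flat.I F → x i ≈ Flat.c F i

  Meets : ∀ {d k} → Flat d k → Box d → Set
  Meets F B = ∃ λ x → InBox x B × InFlat x F

  Family : ℕ → Set₁
  Family d = Box d → Set

  HasFiniteTransversal : ∀ {d} (k : ℕ) → Family d → Set
  HasFiniteTransversal {d} k 𝓕 =
    ∃ λ (T : List (Flat d k)) →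
      ∀ B → 𝓕 B → ∃ λ F → (F ∈L T) × Meets F B

-- Take 𝓕₀ to be the diagonal cubes [m, m + ½]ᵈ, m ∈ ℕ, and 𝓕ₘ₊₁ the points
-- (tⱼ, …, tⱼ) with tⱼ = m + 2⁻⁽ʲ⁺¹⁾ ∈ [m, m + ½]. Since k < d, every k-flat fixes
-- some coordinate, and a single value of that coordinate lies in at most one of
-- the pairwise disjoint intervals [m, m + ½], resp. equals at most one tⱼ; so by
-- pigeonhole no finite set of k-flats meets every member of some 𝓕ₙ. On the other
-- hand, if B₀ = [m, m + ½]ᵈ then Bₘ₊₁ is a point of B₀, and any k-flat through
-- that point meets both.
module Submission where

open import Defs
open import Data.Nat using (ℕ; _<_)
open import Data.Product using (∃; _×_)
open import Relation.Nullary using (¬_)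
open import Relation.Binary.PropositionalEquality using (_≢_)

open import Data.Nat as ℕ using (zero; suc; z≤n; s≤s; _≤′_; ≤′-refl; ≤′-step)
import Data.Nat.Properties as ℕ
open import Data.Fin as Fin using (Fin; toℕ)
open import Data.Fin.Properties using (pigeonhole)
open import Data.Fin.Subset as Subset using (Subset; inside; outside; Nonempty; ∣_∣)
open import Data.Fin.Subset.Properties using (∣⊥∣≡0)
open import Data.Vec using (_∷_; here; there)
open import Data.List using (List; length; lookup)
open import Data.List.Relation.Unary.Any using (index)
open import Data.List.Relation.Unary.Any.Properties using (lookup-index)
open import Data.List.Membership.Propositional renaming (_∈_ to _∈ᴸ_)
open import Data.Product using (Σ; _,_; proj₁; proj₂)
open import Data.Sum using (inj₁; inj₂)
open import Data.Empty using (⊥)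
open import Relation.Nullary using (contradiction)
open import Relation.Binary.PropositionalEquality as ≡ using (_≡_; module ≡-Reasoning)
open import Relation.Binary.Structures using (IsTotalOrder)
open import Relation.Binary.Bundles using (Poset)
import Relation.Binary.Reasoning.PartialOrder as PosetReasoning
open import Algebra.Bundles using (CommutativeRing)
open import Algebra.Properties.Ring using (-1*x≈-x)
open import Algebra.Properties.Group using (⁻¹-involutive)

subset-of-size : ∀ {d r} → r ℕ.≤ d → Σ (Subset d) λ I → ∣ I ∣ ≡ r
subset-of-size {d} z≤n = Subset.⊥ , ∣⊥∣≡0 d
subset-of-size (s≤s r≤d)
  with I , ∣I∣≡r ← subset-of-size r≤d = inside ∷ I , ≡.cong suc ∣I∣≡r

∣p∣>0⇒Nonempty : ∀ {d} (p : Subset d) → 0 < ∣ p ∣ → Nonempty p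
∣p∣>0⇒Nonempty (inside ∷ p) _ = Fin.zero , here
∣p∣>0⇒Nonempty (outside ∷ p) ∣p∣>0
  with i , i∈p ← ∣p∣>0⇒Nonempty p ∣p∣>0 = Fin.suc i , there i∈p

finite-list-misses-exclusive : {A : Set} (R : ℕ → A → Set) →
  (∀ {m n a} → m < n → R m a → R n a → ⊥) →
  (T : List A) → ¬ (∀ n → ∃ λ a → a ∈ᴸ T × R n a)
finite-list-misses-exclusive {A} R exclusive T cover =
  collision⇒⊥ (pigeonhole (ℕ.n<1+n (length T)) position)
  where
  witness : Fin (suc (length T)) → A
  witness i = proj₁ (cover (toℕ i))

  witness∈T : ∀ i → witness i ∈ᴸ T
  witness∈T i = proj₁ (proj₂ (cover (toℕ i)))

  position : Fin (suc (length T)) → Fin (length T)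
  position i = index (witness∈T i)

  collision⇒⊥ : ∃ (λ i → ∃ λ j → i Fin.< j × position i ≡ position j) → ⊥
  collision⇒⊥ (i , j , i<j , same-position) =
    exclusive i<j (R-at i) (≡.subst (R (toℕ j)) (≡.sym same-witness) (R-at j))
    where
    R-at : ∀ i → R (toℕ i) (witness i)
    R-at i = proj₂ (proj₂ (cover (toℕ i)))

    same-witness : witness i ≡ witness j
    same-witness = begin
      witness i             ≡⟨ lookup-index (witness∈T i) ⟩
      lookup T (position i) ≡⟨ ≡.cong (lookup T) same-position ⟩
      lookup T (position j) ≡⟨ lookup-index (witness∈T j) ⟨
      witness j             ∎
      where open ≡-Reasoning

module OrderedFieldProperties (ℝ : RealNumbers) where
  -- Defs declares no fixity for _≤_, so it would bind tighter than _+_.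
  open RealNumbers ℝ renaming (_≤_ to infix 4 _≤_)
  open IsTotalOrder isTotalOrder public
    using (total; antisym; ≤-respˡ-≈; ≤-respʳ-≈)
    renaming (refl to ≤-refl; trans to ≤-trans; reflexive to ≤-reflexive)

  poset : Poset _ _ _
  poset = record { isPartialOrder = IsTotalOrder.isPartialOrder isTotalOrder }

  open PosetReasoning poset

  infix 4 _<ᵣ_
  _<ᵣ_ : Carrier → Carrier → Set
  x <ᵣ y = ¬ (y ≤ x)

  <ᵣ⇒≤ : ∀ {x y} → x <ᵣ y → x ≤ y
  <ᵣ⇒≤ {x} {y} x<y with total x y
  ... | inj₁ x≤y = x≤y
  ... | inj₂ y≤x = contradiction y≤x x<y

  ≤-<ᵣ-trans : ∀ {x y z} → x ≤ y → y <ᵣ z → x <ᵣ z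
  ≤-<ᵣ-trans x≤y y<z z≤x = y<z (≤-trans z≤x x≤y)

  +-monoʳ-≤ : ∀ {x y} z → x ≤ y → z + x ≤ z + y
  +-monoʳ-≤ {x} {y} z x≤y = begin
    z + x ≈⟨ +-comm z x ⟩
    x + z ≤⟨ +-mono-≤ z x≤y ⟩
    y + z ≈⟨ +-comm y z ⟩
    z + y ∎

  +-mono₂-≤ : ∀ {x y u v} → x ≤ y → u ≤ v → x + u ≤ y + v
  +-mono₂-≤ {x} {y} {u} {v} x≤y u≤v = begin
    x + u ≤⟨ +-mono-≤ u x≤y ⟩
    y + u ≤⟨ +-monoʳ-≤ y u≤v ⟩
    y + v ∎

  +-cancelˡ-≤ : ∀ {x y} z → z + x ≤ z + y → x ≤ y
  +-cancelˡ-≤ {x} {y} z z+x≤z+y = begin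
    x              ≈⟨ uncancel x ⟨
    - z + (z + x)  ≤⟨ +-monoʳ-≤ (- z) z+x≤z+y ⟩
    - z + (z + y)  ≈⟨ uncancel y ⟩
    y              ∎
    where
    uncancel : ∀ w → - z + (z + w) ≈ w
    uncancel w = begin-equality
      - z + (z + w) ≈⟨ +-assoc (- z) z w ⟨
      (- z + z) + w ≈⟨ +-congʳ (-‿inverseˡ z) ⟩
      0# + w        ≈⟨ +-identityˡ w ⟩
      w             ∎

  +-monoʳ-<ᵣ : ∀ {x y} z → x <ᵣ y → z + x <ᵣ z + y
  +-monoʳ-<ᵣ z x<y z+y≤z+x = x<y (+-cancelˡ-≤ z z+y≤z+x)

  0<1 : 0# <ᵣ 1#
  0<1 1≤0 = 0≉1 (antisym 0≤1 1≤0)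
    where
    0≤-1 : 0# ≤ - 1#
    0≤-1 = begin
      0#         ≈⟨ -‿inverseʳ 1# ⟨
      1# + - 1#  ≤⟨ +-mono-≤ (- 1#) 1≤0 ⟩
      0# + - 1#  ≈⟨ +-identityˡ (- 1#) ⟩
      - 1#       ∎
    0≤1 : 0# ≤ 1#
    0≤1 = begin
      0#           ≤⟨ *-nonneg 0≤-1 0≤-1 ⟩
      - 1# * - 1#  ≈⟨ -1*x≈-x (CommutativeRing.ring commRing) (- 1#) ⟩
      - - 1#       ≈⟨ ⁻¹-involutive +-group 1# ⟩
      1#           ∎

  x<x+1 : ∀ x → x <ᵣ x + 1#
  x<x+1 x = ≤-<ᵣ-trans (≤-reflexive (sym (+-identityʳ x))) (+-monoʳ-<ᵣ x 0<1)

  1+1≉0 : ¬ (1# + 1# ≈ 0#)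
  1+1≉0 two≈0 = x<x+1 1# (≤-trans (≤-reflexive two≈0) (<ᵣ⇒≤ 0<1))

  half : Carrier
  half = proj₁ (inverse (1# + 1#) 1+1≉0)

  x*half+x*half≈x : ∀ x → x * half + x * half ≈ x
  x*half+x*half≈x x = begin-equality
    x * half + x * half         ≈⟨ distribˡ x half half ⟨
    x * (half + half)           ≈⟨ *-congˡ (+-cong (*-identityˡ half) (*-identityˡ half)) ⟨
    x * (1# * half + 1# * half) ≈⟨ *-congˡ (distribʳ half 1# 1#) ⟨
    x * ((1# + 1#) * half)      ≈⟨ *-congˡ (proj₂ (inverse (1# + 1#) 1+1≉0)) ⟩
    x * 1#                      ≈⟨ *-identityʳ x ⟩
    x                           ∎

  half^ : ℕ → Carrier
  half^ zero    = 1#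
  half^ (suc n) = half^ n * half

  0<x⇒0<x*half : ∀ {x} → 0# <ᵣ x → 0# <ᵣ x * half
  0<x⇒0<x*half {x} 0<x x*half≤0 = 0<x (begin
    x                   ≈⟨ x*half+x*half≈x x ⟨
    x * half + x * half ≤⟨ +-mono₂-≤ x*half≤0 x*half≤0 ⟩
    0# + 0#             ≈⟨ +-identityʳ 0# ⟩
    0#                  ∎)

  0<x⇒x*half<x : ∀ {x} → 0# <ᵣ x → x * half <ᵣ x
  0<x⇒x*half<x {x} 0<x x≤x*half = 0<x⇒0<x*half 0<x (+-cancelˡ-≤ (x * half) (begin
    x * half + x * half ≈⟨ x*half+x*half≈x x ⟩
    x                   ≤⟨ x≤x*half ⟩
    x * half            ≈⟨ +-identityʳ (x * half) ⟨
    x * half + 0#       ∎))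

  0<half^ : ∀ n → 0# <ᵣ half^ n
  0<half^ zero    = 0<1
  0<half^ (suc n) = 0<x⇒0<x*half (0<half^ n)

  half^-antitone : ∀ {m n} → m ≤′ n → half^ n ≤ half^ m
  half^-antitone ≤′-refl            = ≤-refl
  half^-antitone (≤′-step {n} m≤n) =
    ≤-trans (<ᵣ⇒≤ (0<x⇒x*half<x (0<half^ n))) (half^-antitone m≤n)

  half^-strictly-antitone : ∀ {m n} → m < n → half^ n <ᵣ half^ m
  half^-strictly-antitone {m} m<n =
    ≤-<ᵣ-trans (half^-antitone (ℕ.≤⇒≤′ m<n)) (0<x⇒x*half<x (0<half^ m))

  fromℕ : ℕ → Carrier
  fromℕ zero    = 0#
  fromℕ (suc n) = fromℕ n + 1#

  fromℕ-mono : ∀ {m n} → m ≤′ n → fromℕ m ≤ fromℕ n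
  fromℕ-mono ≤′-refl        = ≤-refl
  fromℕ-mono (≤′-step m≤n) = ≤-trans (fromℕ-mono m≤n) (<ᵣ⇒≤ (x<x+1 _))

module AxisParallel (ℝ : RealNumbers) where
  open RealNumbers ℝ renaming (_≤_ to infix 4 _≤_)
  open OrderedFieldProperties ℝ

  infix 4 _∈[_,_]
  _∈[_,_] : Carrier → Carrier → Carrier → Set
  v ∈[ a , b ] = a ≤ v × v ≤ b

  cube : ∀ {d} a b → a ≤ b → Box ℝ d
  cube a b a≤b = box (λ _ → a) (λ _ → b) (λ _ → a≤b)

  flat-through : ∀ {d} k → (Fin d → Carrier) → Flat ℝ d k
  flat-through {d} k x = flat (proj₁ I) (proj₂ I) x
    where I = subset-of-size (ℕ.m∸n≤m d k)

  meets-flat-through : ∀ {d} k {x} {B : Box ℝ d} → InBox ℝ x B → Meets ℝ (flat-through k x) B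
  meets-flat-through k {x} x∈B = x , x∈B , λ _ _ → refl

  diagonal-flat-meets-cube : ∀ {d} k {a b v} (a≤b : a ≤ b) → v ∈[ a , b ] →
    Meets ℝ (flat-through k (λ _ → v)) (cube {d} a b a≤b)
  diagonal-flat-meets-cube k {a} {b} a≤b v∈[a,b] =
    meets-flat-through k {B = cube a b a≤b} (λ _ → v∈[a,b])

  fixed-coordinate : ∀ {d k} → k < d → (F : Flat ℝ d k) → Nonempty (Flat.I F)
  fixed-coordinate k<d F =
    ∣p∣>0⇒Nonempty (Flat.I F) (≡.subst (0 <_) (≡.sym (Flat.|I| F)) (ℕ.m<n⇒0<n∸m k<d))

  meets-cube⇒fixed-value-∈ : ∀ {d k a b} {a≤b : a ≤ b} (F : Flat ℝ d k) {i} →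
    i Subset.∈ Flat.I F → Meets ℝ F (cube a b a≤b) → Flat.c F i ∈[ a , b ]
  meets-cube⇒fixed-value-∈ F {i} i∈I (x , x∈B , x∈F) =
    ≤-respʳ-≈ (x∈F i i∈I) (proj₁ (x∈B i)) , ≤-respˡ-≈ (x∈F i i∈I) (proj₂ (x∈B i))

  Cubes : ∀ {d} (a b : ℕ → Carrier) → (∀ n → a n ≤ b n) → Family ℝ d
  Cubes a b a≤b B = ∃ λ n → B ≡ cube (a n) (b n) (a≤b n)

  PairwiseDisjoint : (a b : ℕ → Carrier) → Set
  PairwiseDisjoint a b = ∀ {m n v} → m < n → v ∈[ a m , b m ] → v ∈[ a n , b n ] → ⊥

  disjoint-cubes-lack-finite-transversal : ∀ {d k} → k < d →
    ∀ {a b} (a≤b : ∀ n → a n ≤ b n) → PairwiseDisjoint a b →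
    ¬ HasFiniteTransversal ℝ k (Cubes {d} a b a≤b)
  disjoint-cubes-lack-finite-transversal {d} {k} k<d {a} {b} a≤b disjoint (T , covers) =
    finite-list-misses-exclusive (λ n F → fixed-value F ∈[ a n , b n ]) disjoint T λ n →
      let F , F∈T , F-meets = covers (cube (a n) (b n) (a≤b n)) (n , ≡.refl)
      in F , F∈T ,
         meets-cube⇒fixed-value-∈ {a≤b = a≤b n} F (proj₂ (fixed-coordinate k<d F)) F-meets
    where
    fixed-value : Flat ℝ d k → Carrier
    fixed-value F = Flat.c F (proj₁ (fixed-coordinate k<d F))

module Construction (ℝ : RealNumbers) where
  open RealNumbers ℝ renaming (_≤_ to infix 4 _≤_)
  open OrderedFieldProperties ℝ
  open AxisParallel ℝ

  cell-end : ℕ → Carrier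
  cell-end n = fromℕ n + half^ 1

  pin : ℕ → ℕ → Carrier
  pin m j = fromℕ m + half^ (suc j)

  pin-∈-cell : ∀ m j → pin m j ∈[ fromℕ m , cell-end m ]
  pin-∈-cell m j =
    ≤-trans (≤-reflexive (sym (+-identityʳ (fromℕ m))))
            (+-monoʳ-≤ (fromℕ m) (<ᵣ⇒≤ (0<half^ (suc j)))) ,
    +-monoʳ-≤ (fromℕ m) (half^-antitone {1} {suc j} (ℕ.≤⇒≤′ (s≤s z≤n)))

  cell-nonempty : ∀ n → fromℕ n ≤ cell-end n
  cell-nonempty n = let pin≥n , pin≤end = pin-∈-cell n 0 in ≤-trans pin≥n pin≤end

  -- fromℕ m + half^ 0 is fromℕ (suc m) by definition, and half^ 1 < half^ 0.
  cells-disjoint : PairwiseDisjoint fromℕ cell-end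
  cells-disjoint {m} m<n (_ , v≤end) (n≤v , _) =
    half^-strictly-antitone {0} {1} (s≤s z≤n)
      (+-cancelˡ-≤ (fromℕ m) (≤-trans (fromℕ-mono (ℕ.≤⇒≤′ m<n)) (≤-trans n≤v v≤end)))

  pins-disjoint : ∀ m → PairwiseDisjoint (pin m) (pin m)
  pins-disjoint m {j} {j′} j<j′ (pinⱼ≤v , _) (_ , v≤pinⱼ′) =
    +-monoʳ-<ᵣ (fromℕ m) (half^-strictly-antitone {suc j} {suc j′} (s≤s j<j′))
      (≤-trans pinⱼ≤v v≤pinⱼ′)

  𝓕 : ∀ {d} → ℕ → Family ℝ d
  𝓕 zero    = Cubes fromℕ cell-end cell-nonempty
  𝓕 (suc m) = Cubes (pin m) (pin m) (λ _ → ≤-refl)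

theorem9 : (ℝ : RealNumbers) → (d k : ℕ) → k < d →
    ∃ λ (𝓕 : ℕ → Family ℝ d) →
      (∀ n → ¬ HasFiniteTransversal ℝ k (𝓕 n)) ×
      ((B : ℕ → Box ℝ d) → (∀ n → 𝓕 n (B n)) →
        ∃ λ i → ∃ λ j → (i ≢ j) ×
          ∃ λ (F : Flat ℝ d k) → Meets ℝ F (B i) × Meets ℝ F (B j))
theorem9 ℝ d k k<d = 𝓕 , no-finite-transversal , two-boxes-share-a-flat
  where
  open OrderedFieldProperties ℝ using (≤-refl)
  open AxisParallel ℝ
  open Construction ℝ

  no-finite-transversal : ∀ n → ¬ HasFiniteTransversal ℝ k (𝓕 {d} n)
  no-finite-transversal zero =
    disjoint-cubes-lack-finite-transversal k<d cell-nonempty cells-disjoint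
  no-finite-transversal (suc m) =
    disjoint-cubes-lack-finite-transversal k<d (λ _ → ≤-refl) (pins-disjoint m)

  two-boxes-share-a-flat : (B : ℕ → Box ℝ d) → (∀ n → 𝓕 n (B n)) →
    ∃ λ i → ∃ λ j → (i ≢ j) × ∃ λ (F : Flat ℝ d k) → Meets ℝ F (B i) × Meets ℝ F (B j)
  two-boxes-share-a-flat B B∈𝓕 = 0 , suc m , (λ ()) , F ,
    ≡.subst (Meets ℝ F) (≡.sym (proj₂ (B∈𝓕 0)))
      (diagonal-flat-meets-cube k (cell-nonempty m) (pin-∈-cell m j)) ,
    ≡.subst (Meets ℝ F) (≡.sym (proj₂ (B∈𝓕 (suc m))))
      (diagonal-flat-meets-cube k ≤-refl (≤-refl , ≤-refl))
    where
    m : ℕ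
    m = proj₁ (B∈𝓕 0)
    j : ℕ
    j = proj₁ (B∈𝓕 (suc m))
    F : Flat ℝ d k
    F = flat-through k (λ _ → pin m j)
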